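{- If $L=\{0,1,3\}$, then $f(n,3,4,L)=2^{\Theta(n\log n)}$ as $n\to\infty$.
   Context: $f(n,3,4,L)$ denotes the number of $3$-uniform hypergraphs on the vertex set $[n]=\{1,\ldots,n\}$ such that no set of $4$ vertices spans exactly $i$ edges for any $i\in L$. Logarithms are in base $2$. -}

module Defs where

open import Data.Nat using (ℕ; zero; suc; _+_; _<ᵇ_; _≡ᵇ_)
open import Data.Bool using (Bool; true; false; _∧_; _∨_; not; if_then_else_)
open import Data.Fin using (Fin; toℕ)
open import Data.List using (List; []; _∷_; _++_; map; filter; length; concatMap)
open import Data.Bool.ListAction using (any; all)
open import Data.List.Base using (allFin)
open import Data.Product using (_×_; _,_)
open import Relation.Nullary.Decidable using (yes; no)
open import Relation.Binary.PropositionalEquality using (_≡_; refl)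
open import Data.Bool.Properties using () renaming (_≟_ to _≟B_)

-- A triple (i , j , k) of vertices of [n] = Fin n; it stands for the
-- 3-set {i,j,k} when i < j < k.
Triple : ℕ → Set
Triple n = Fin n × Fin n × Fin n

_<F_ : ∀ {n} → Fin n → Fin n → Bool
i <F j = toℕ i <ᵇ toℕ j

_=F_ : ∀ {n} → Fin n → Fin n → Bool
i =F j = toℕ i ≡ᵇ toℕ j

_=T_ : ∀ {n} → Triple n → Triple n → Bool
(a , b , c) =T (a' , b' , c') = (a =F a') ∧ ((b =F b') ∧ (c =F c'))

triples : (n : ℕ) → List (Triple n)
triples n =
  concatMap (λ i → concatMap (λ j → concatMap (λ k →
    if (i <F j) ∧ (j <F k) then (i , j , k) ∷ [] else [])
    (allFin n)) (allFin n)) (allFin n)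

quads : (n : ℕ) → List (Fin n × Fin n × Fin n × Fin n)
quads n =
  concatMap (λ a → concatMap (λ b → concatMap (λ c → concatMap (λ d →
    if (a <F b) ∧ ((b <F c) ∧ (c <F d)) then (a , b , c , d) ∷ [] else [])
    (allFin n)) (allFin n)) (allFin n)) (allFin n)

sublists : ∀ {A : Set} → List A → List (List A)
sublists [] = [] ∷ []
sublists (x ∷ xs) = sublists xs ++ map (x ∷_) (sublists xs)

-- A 3-uniform hypergraph on [n]: a set of 3-subsets of [n], represented
-- as a sublist of (triples n).  The hypergraphs on [n] are exactly
-- the elements of  sublists (triples n).
Hypergraph : ℕ → Set
Hypergraph n = List (Triple n)

allHypergraphs : (n : ℕ) → List (Hypergraph n)
allHypergraphs n = sublists (triples n)

isEdge : ∀ {n} → Hypergraph n → Triple n → Bool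
isEdge H t = any (λ e → e =T t) H

b2n : Bool → ℕ
b2n true = 1
b2n false = 0

spanned : ∀ {n} → Hypergraph n → Fin n × Fin n × Fin n × Fin n → ℕ
spanned H (a , b , c , d) =
  b2n (isEdge H (a , b , c)) + b2n (isEdge H (a , b , d))
  + b2n (isEdge H (a , c , d)) + b2n (isEdge H (b , c , d))

_∈ᵇ_ : ℕ → List ℕ → Bool
m ∈ᵇ L = any (λ x → m ≡ᵇ x) L

admissible : ∀ {n} → List ℕ → Hypergraph n → Bool
admissible L H = all (λ q → not (spanned H q ∈ᵇ L)) (quads _)

f : ℕ → List ℕ → ℕ
f n L = length (filter (λ H → admissible L H ≟B true) (allHypergraphs n))

{-# OPTIONS --safe #-}
-- Both allowed numbers of edges on a 4-set, 2 and 4, are even.  Hence in an admissible H the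
-- triple {a, b, c} is an edge iff an even number of the pairs ab, ac, bc are edges of the graph
-- K = coLink H, the complement of the link of vertex 0 (with 0 isolated): H is the hypergraph of
-- even triples of K.  Checking the 4-sets, that hypergraph is admissible iff K is triangle-free
-- and has no induced 2K2, so f(n) counts such graphs.
--
-- Upper bound: an edge uv splits such a graph into the independent sets N(v), N(u) ∖ N(v) and
-- the rest; between two parts the neighbourhoods are nested, so x ~ y iff a threshold of x is at
-- most the degree of y into the part of x.  Each vertex is described by seven numbers ≤ n + 1,
-- whence f(n) ≤ n^(13n).
--
-- Lower bound: for k ≈ n/2 the bipartite chain graphs joining 1 + i to k + j iff j ≤ g(i), one
-- for each g : [k] → {0, …, k}, give (k + 1)^k distinct admissible hypergraphs, whence
-- n^n ≤ f(n)^8.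
module Submission where

open import Defs
open import Data.Nat using (ℕ; _*_; _^_; _≤_; _<_)
open import Data.List using (_∷_; [])
open import Data.Product using (_×_; ∃-syntax)

open import Data.Bool using (Bool; true; false; not; _∧_; _∨_; _xor_; if_then_else_; T)
open import Data.Bool.Properties
  using (T-≡; T-∧; not-involutive; not-injective; ∨-comm; ∨-identityʳ; ∧-zeroʳ) renaming (_≟_ to _≟ᵇ_)
open import Data.Bool.ListAction using (all)
open import Data.Empty using (⊥; ⊥-elim)
open import Data.Fin as Fin using (Fin; toℕ; fromℕ<; combine; funToFin; finToFun; #_)
  renaming (_<_ to _<ᶠ_)
import Data.Fin.Properties as Finₚ
open import Data.List using (List; map; filter; length; concatMap; allFin; lookup)
open import Data.List.Membership.Propositional using (_∈_; _∉_; find; lose)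
open import Data.List.Membership.Propositional.Properties
  using (∈-++⁺ˡ; ∈-++⁺ʳ; ∈-++⁻; ∈-map⁺; ∈-map⁻; ∈-concatMap⁺; ∈-concatMap⁻; ∈-allFin; ∈-lookup;
         ∈-filter⁺; ∈-filter⁻)
import Data.List.Membership.Setoid.Properties as Membershipₛ
open import Data.List.Relation.Binary.Subset.Propositional using (_⊆_)
open import Data.List.Relation.Unary.All using ([]; _∷_)
open import Data.List.Relation.Unary.AllPairs using ([]; _∷_)
open import Data.List.Relation.Unary.Any using (here; there)
open import Data.List.Relation.Unary.Unique.Propositional using (Unique)
import Data.List.Relation.Unary.Unique.Propositional.Properties as Uniqueₚ
open import Data.Nat using (zero; suc; _+_; _∸_; _⊓_; _≤ᵇ_; _<ᵇ_; z≤n; s≤s; s≤s⁻¹; z<s)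
open import Data.Nat.Properties
open import Data.Nat.Tactic.RingSolver using (solve-∀)
open import Data.Product using (Σ; _,_; proj₁; proj₂; ∃) renaming (map to Σ-map)
open import Data.Sum using (_⊎_; inj₁; inj₂)
open import Function using (_∘_; id; Equivalence)
open import Relation.Binary.Definitions using (tri<; tri≈; tri>)
open import Relation.Binary.PropositionalEquality
  using (_≡_; _≢_; refl; sym; trans; cong; cong₂; subst; setoid)
open import Relation.Nullary using (¬_; yes; no; Dec)

T⇒≡true : ∀ {b} → T b → b ≡ true
T⇒≡true = Equivalence.to T-≡

≡true⇒T : ∀ {b} → b ≡ true → T b
≡true⇒T = Equivalence.from T-≡

true≢false : true ≢ false
true≢false ()

∧-true⁻ : ∀ {a b} → a ∧ b ≡ true → a ≡ true × b ≡ true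
∧-true⁻ {true} {true} _ = refl , refl

∧-true⁺ : ∀ {a b} → a ≡ true → b ≡ true → a ∧ b ≡ true
∧-true⁺ refl refl = refl

∨-true⁻ : ∀ {a b} → a ∨ b ≡ true → a ≡ true ⊎ b ≡ true
∨-true⁻ {true} _ = inj₁ refl
∨-true⁻ {false} h = inj₂ h

∨-false⁻ : ∀ {a b} → a ∨ b ≡ false → a ≡ false × b ≡ false
∨-false⁻ {false} {false} _ = refl , refl

not-true⁻ : ∀ {a} → not a ≡ true → a ≡ false
not-true⁻ {false} _ = refl

≢true⇒≡false : ∀ {a} → a ≢ true → a ≡ false
≢true⇒≡false {true} h = ⊥-elim (h refl)
≢true⇒≡false {false} _ = refl

BoolFun : ℕ → Set
BoolFun zero = Bool
BoolFun (suc n) = Bool → BoolFun n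

Valid : ∀ n → BoolFun n → Set
Valid zero b = b ≡ true
Valid (suc n) φ = ∀ b → Valid n (φ b)

valid? : ∀ n → BoolFun n → Bool
valid? zero b = b
valid? (suc n) φ = valid? n (φ true) ∧ valid? n (φ false)

-- The implicit argument is discharged by evaluating all 2ⁿ rows of the truth table.
valid : ∀ n (φ : BoolFun n) {_ : T (valid? n φ)} → Valid n φ
valid zero b {t} = T⇒≡true t
valid (suc n) φ {t} true = valid n (φ true) {proj₁ (Equivalence.to T-∧ t)}
valid (suc n) φ {t} false = valid n (φ false) {proj₂ (Equivalence.to T-∧ t)}

_⇒ᵇ_ : Bool → Bool → Bool
a ⇒ᵇ b = not a ∨ b

⇒ᵇ-sound : ∀ {a b} → (a ⇒ᵇ b) ≡ true → a ≡ true → b ≡ true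
⇒ᵇ-sound h refl = h

_==_ : Bool → Bool → Bool
a == b = not (a xor b)

==-sound : ∀ {a b} → (a == b) ≡ true → a ≡ b
==-sound {true} {true} _ = refl
==-sound {false} {false} _ = refl

module _ {A : Set} where

  all-true⁻ : ∀ (p : A → Bool) {xs x} → all p xs ≡ true → x ∈ xs → p x ≡ true
  all-true⁻ p {y ∷ ys} h (here refl) = proj₁ (∧-true⁻ {p y} h)
  all-true⁻ p {y ∷ ys} h (there m) = all-true⁻ p (proj₂ (∧-true⁻ {p y} h)) m

  all-true⁺ : ∀ (p : A → Bool) xs → (∀ {x} → x ∈ xs → p x ≡ true) → all p xs ≡ true
  all-true⁺ p [] h = refl
  all-true⁺ p (y ∷ ys) h = ∧-true⁺ (h (here refl)) (all-true⁺ p ys (h ∘ there))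

  ∈-singleton-if : ∀ {c} {t : A} → c ≡ true → t ∈ (if c then t ∷ [] else [])
  ∈-singleton-if refl = here refl

  ∈-singleton-if⁻ : ∀ c (t : A) {y} → y ∈ (if c then t ∷ [] else []) → c ≡ true × y ≡ t
  ∈-singleton-if⁻ true t (here refl) = refl , refl

  unique-singleton-if : ∀ c (t : A) → Unique (if c then t ∷ [] else [])
  unique-singleton-if true t = [] ∷ []
  unique-singleton-if false t = []

  boolFilter : (A → Bool) → List A → List A
  boolFilter p [] = []
  boolFilter p (x ∷ xs) = if p x then x ∷ boolFilter p xs else boolFilter p xs

  ∈-boolFilter⁻ : ∀ (p : A → Bool) {xs x} → x ∈ boolFilter p xs → p x ≡ true
  ∈-boolFilter⁻ p {y ∷ xs} m with p y in eq
  ∈-boolFilter⁻ p {y ∷ xs} (here refl) | true = eq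
  ∈-boolFilter⁻ p {y ∷ xs} (there m) | true = ∈-boolFilter⁻ p {xs} m
  ... | false = ∈-boolFilter⁻ p {xs} m

  ∈-boolFilter⁺ : ∀ (p : A → Bool) {xs x} → x ∈ xs → p x ≡ true → x ∈ boolFilter p xs
  ∈-boolFilter⁺ p {y ∷ xs} (here refl) px rewrite px = here refl
  ∈-boolFilter⁺ p {y ∷ xs} (there m) px with p y
  ... | true = there (∈-boolFilter⁺ p {xs} m px)
  ... | false = ∈-boolFilter⁺ p {xs} m px

  boolFilter∈sublists : ∀ (p : A → Bool) xs → boolFilter p xs ∈ sublists xs
  boolFilter∈sublists p [] = here refl
  boolFilter∈sublists p (x ∷ xs) with p x
  ... | true = ∈-++⁺ʳ (sublists xs) (∈-map⁺ (x ∷_) (boolFilter∈sublists p xs))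
  ... | false = ∈-++⁺ˡ (boolFilter∈sublists p xs)

  ∈-sublists-∷⁻ : ∀ x xs {ys} → ys ∈ sublists (x ∷ xs) →
    ys ∈ sublists xs ⊎ Σ (List A) λ zs → ys ≡ x ∷ zs × zs ∈ sublists xs
  ∈-sublists-∷⁻ x xs m with ∈-++⁻ (sublists xs) m
  ... | inj₁ m₁ = inj₁ m₁
  ... | inj₂ m₂ with ∈-map⁻ (x ∷_) m₂
  ... | zs , m₀ , eq = inj₂ (zs , eq , m₀)

  sublists-⊆ : ∀ xs {ys} → ys ∈ sublists xs → ys ⊆ xs
  sublists-⊆ [] (here refl) ()
  sublists-⊆ (x ∷ xs) m y∈ys with ∈-sublists-∷⁻ x xs m
  ... | inj₁ m₁ = there (sublists-⊆ xs m₁ y∈ys)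
  ... | inj₂ (zs , refl , m₀) with y∈ys
  ... | here refl = here refl
  ... | there y∈zs = there (sublists-⊆ xs m₀ y∈zs)

  private
    ∉-unique-head : ∀ {x : A} {xs} → Unique (x ∷ xs) → x ∉ xs
    ∉-unique-head (x≢xs ∷ _) = Membershipₛ.All[≉]⇒∉ (setoid A) x≢xs

  sublists-extensional : ∀ xs → Unique xs → ∀ {ys zs} → ys ∈ sublists xs → zs ∈ sublists xs →
    ys ⊆ zs → zs ⊆ ys → ys ≡ zs
  sublists-extensional [] u (here refl) (here refl) _ _ = refl
  sublists-extensional (x ∷ xs) u@(_ ∷ u′) m m′ ys⊆zs zs⊆ys
    with ∈-sublists-∷⁻ x xs m | ∈-sublists-∷⁻ x xs m′
  ... | inj₁ m₁ | inj₁ m₁′ = sublists-extensional xs u′ m₁ m₁′ ys⊆zs zs⊆ys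
  ... | inj₁ m₁ | inj₂ (_ , refl , _) = ⊥-elim (∉-unique-head u (sublists-⊆ xs m₁ (zs⊆ys (here refl))))
  ... | inj₂ (_ , refl , _) | inj₁ m₁′ = ⊥-elim (∉-unique-head u (sublists-⊆ xs m₁′ (ys⊆zs (here refl))))
  ... | inj₂ (ys′ , refl , m₀) | inj₂ (zs′ , refl , m₀′) =
    cong (x ∷_) (sublists-extensional xs u′ m₀ m₀′ (tail m₀ ys⊆zs) (tail m₀′ zs⊆ys))
    where
    tail : ∀ {vs ws} → vs ∈ sublists xs → (x ∷ vs) ⊆ (x ∷ ws) → vs ⊆ ws
    tail vs∈ vs⊆ y∈vs with vs⊆ (there y∈vs)
    ... | here refl = ⊥-elim (∉-unique-head u (sublists-⊆ xs vs∈ y∈vs))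
    ... | there y∈ws = y∈ws

  sublists-unique : ∀ xs → Unique xs → Unique (sublists xs)
  sublists-unique [] _ = [] ∷ []
  sublists-unique (x ∷ xs) u@(_ ∷ u′) =
    Uniqueₚ.++⁺ (sublists-unique xs u′) (Uniqueₚ.map⁺ ∷-injectiveʳ (sublists-unique xs u′)) disjoint
    where
    ∷-injectiveʳ : ∀ {ys zs} → (List._∷_ x ys) ≡ x ∷ zs → ys ≡ zs
    ∷-injectiveʳ refl = refl
    disjoint : ∀ {ys} → ¬ (ys ∈ sublists xs × ys ∈ map (x ∷_) (sublists xs))
    disjoint (m₁ , m₂) with ∈-map⁻ (x ∷_) m₂
    ... | _ , _ , refl = ∉-unique-head u (sublists-⊆ xs m₁ (here refl))

  concatMap-unique : ∀ {B : Set} (key : B → A) (f : A → List B) {xs} → Unique xs →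
    (∀ x → Unique (f x)) → (∀ {x y} → y ∈ f x → key y ≡ x) → Unique (concatMap f xs)
  concatMap-unique key f [] uf kf = []
  concatMap-unique key f {x ∷ xs} u@(_ ∷ u′) uf kf =
    Uniqueₚ.++⁺ (uf x) (concatMap-unique key f u′ uf kf) disjoint
    where
    disjoint : ∀ {v} → ¬ (v ∈ f x × v ∈ concatMap f xs)
    disjoint (m₁ , m₂) with find (∈-concatMap⁻ f m₂)
    ... | x′ , x′∈xs , m = ∉-unique-head u (subst (_∈ xs) (trans (sym (kf m)) (kf m₁)) x′∈xs)

  unique-length≤ : ∀ {xs : List A} {k} → Unique xs → (c : ∀ {x} → x ∈ xs → Fin k) →
    (∀ {x y} (p : x ∈ xs) (q : y ∈ xs) → c p ≡ c q → x ≡ y) → length xs ≤ k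
  unique-length≤ {xs} u c c-inj =
    Finₚ.injective⇒≤ (λ {i} {j} e → lookup-injective u i j (c-inj (∈-lookup i) (∈-lookup j) e))
    where
    lookup-injective : ∀ {ys : List A} → Unique ys → ∀ i j → lookup ys i ≡ lookup ys j → i ≡ j
    lookup-injective {_ ∷ _} u′ Fin.zero Fin.zero e = refl
    lookup-injective {_ ∷ _} u′ Fin.zero (Fin.suc j) e =
      ⊥-elim (∉-unique-head u′ (subst (_∈ _) (sym e) (∈-lookup j)))
    lookup-injective {_ ∷ _} u′ (Fin.suc i) Fin.zero e =
      ⊥-elim (∉-unique-head u′ (subst (_∈ _) e (∈-lookup i)))
    lookup-injective {_ ∷ _} (_ ∷ u′) (Fin.suc i) (Fin.suc j) e = cong Fin.suc (lookup-injective u′ i j e)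

  ≤-length : ∀ {xs : List A} {k} (g : Fin k → A) → (∀ {i j} → g i ≡ g j → i ≡ j) →
    (∀ i → g i ∈ xs) → k ≤ length xs
  ≤-length g g-inj g∈ =
    Finₚ.injective⇒≤ (λ {i} {j} e → g-inj (Membershipₛ.index-injective (setoid A) (g∈ i) (g∈ j) e))

module _ {n : ℕ} where

  <F-true : ∀ {a b : Fin n} → a <ᶠ b → (a <F b) ≡ true
  <F-true lt = T⇒≡true (<⇒<ᵇ lt)

  <F-sound : ∀ {a b : Fin n} → (a <F b) ≡ true → a <ᶠ b
  <F-sound {a} {b} h = <ᵇ⇒< (toℕ a) (toℕ b) (≡true⇒T h)

  <F-false : ∀ {a b : Fin n} → b <ᶠ a → (a <F b) ≡ false
  <F-false lt = ≢true⇒≡false (λ h → <-asym (<F-sound h) lt)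

  =F-sound : ∀ {i j : Fin n} → (i =F j) ≡ true → i ≡ j
  =F-sound {i} {j} h = Finₚ.toℕ-injective (≡ᵇ⇒≡ (toℕ i) (toℕ j) (≡true⇒T h))

  =F-refl : ∀ (i : Fin n) → (i =F i) ≡ true
  =F-refl i = T⇒≡true (≡⇒≡ᵇ (toℕ i) (toℕ i) refl)

  =F-false : ∀ {i j : Fin n} → i ≢ j → (i =F j) ≡ false
  =F-false i≢j = ≢true⇒≡false (i≢j ∘ =F-sound)

  =T-sound : ∀ {s t : Triple n} → (s =T t) ≡ true → s ≡ t
  =T-sound {a , b , c} {a′ , b′ , c′} h with ∧-true⁻ {a =F a′} h
  ... | h₁ , h₂₃ with ∧-true⁻ {b =F b′} h₂₃
  ... | h₂ , h₃ with =F-sound {a} {a′} h₁ | =F-sound {b} {b′} h₂ | =F-sound {c} {c′} h₃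
  ... | refl | refl | refl = refl

  =T-refl : ∀ (t : Triple n) → (t =T t) ≡ true
  =T-refl (a , b , c) = ∧-true⁺ (=F-refl a) (∧-true⁺ (=F-refl b) (=F-refl c))

  isEdge-sound : ∀ (H : Hypergraph n) {t} → isEdge H t ≡ true → t ∈ H
  isEdge-sound (e ∷ H) {t} h with ∨-true⁻ {e =T t} h
  ... | inj₁ h₁ = here (sym (=T-sound h₁))
  ... | inj₂ h₂ = there (isEdge-sound H h₂)

  isEdge-complete : ∀ (H : Hypergraph n) {t} → t ∈ H → isEdge H t ≡ true
  isEdge-complete (e ∷ H) {t} (here refl) rewrite =T-refl t = refl
  isEdge-complete (e ∷ H) {t} (there m) with e =T t
  ... | true = refl
  ... | false = isEdge-complete H m

  isEdge-boolFilter : ∀ (E : Triple n → Bool) {ts t} → t ∈ ts → isEdge (boolFilter E ts) t ≡ E t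
  isEdge-boolFilter E {ts} {t} m with E t in eq
  ... | true = isEdge-complete _ (∈-boolFilter⁺ E m eq)
  ... | false = ≢true⇒≡false λ h → true≢false (trans (sym (∈-boolFilter⁻ E {ts} (isEdge-sound _ h))) eq)

  ∈-triples⁺ : ∀ {a b c : Fin n} → a <ᶠ b → b <ᶠ c → (a , b , c) ∈ triples n
  ∈-triples⁺ {a} {b} {c} ab bc =
    ∈-concatMap⁺ _ (lose (∈-allFin a) (∈-concatMap⁺ _ (lose (∈-allFin b) (∈-concatMap⁺ _
      (lose (∈-allFin c) (∈-singleton-if (∧-true⁺ (<F-true ab) (<F-true bc))))))))

  ∈-triples⁻ : ∀ {a b c : Fin n} → (a , b , c) ∈ triples n → a <ᶠ b × b <ᶠ c
  ∈-triples⁻ m with find (∈-concatMap⁻ _ {xs = allFin n} m)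
  ... | a , _ , m₁ with find (∈-concatMap⁻ _ {xs = allFin n} m₁)
  ... | b , _ , m₂ with find (∈-concatMap⁻ _ {xs = allFin n} m₂)
  ... | c , _ , m₃ with ∈-singleton-if⁻ ((a <F b) ∧ (b <F c)) (a , b , c) m₃
  ... | h , refl = <F-sound (proj₁ (∧-true⁻ h)) , <F-sound (proj₂ (∧-true⁻ {a <F b} h))

  ∈-quads⁺ : ∀ {a b c d : Fin n} → a <ᶠ b → b <ᶠ c → c <ᶠ d → (a , b , c , d) ∈ quads n
  ∈-quads⁺ {a} {b} {c} {d} ab bc cd =
    ∈-concatMap⁺ _ (lose (∈-allFin a) (∈-concatMap⁺ _ (lose (∈-allFin b) (∈-concatMap⁺ _
      (lose (∈-allFin c) (∈-concatMap⁺ _ (lose (∈-allFin d)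
        (∈-singleton-if (∧-true⁺ (<F-true ab) (∧-true⁺ (<F-true bc) (<F-true cd)))))))))))

  ∈-quads⁻ : ∀ {a b c d : Fin n} → (a , b , c , d) ∈ quads n → a <ᶠ b × b <ᶠ c × c <ᶠ d
  ∈-quads⁻ m with find (∈-concatMap⁻ _ {xs = allFin n} m)
  ... | a , _ , m₁ with find (∈-concatMap⁻ _ {xs = allFin n} m₁)
  ... | b , _ , m₂ with find (∈-concatMap⁻ _ {xs = allFin n} m₂)
  ... | c , _ , m₃ with find (∈-concatMap⁻ _ {xs = allFin n} m₃)
  ... | d , _ , m₄ with ∈-singleton-if⁻ ((a <F b) ∧ ((b <F c) ∧ (c <F d))) (a , b , c , d) m₄
  ... | h , refl with ∧-true⁻ {a <F b} h
  ... | ab , h′ with ∧-true⁻ {b <F c} h′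
  ... | bc , cd = <F-sound ab , <F-sound bc , <F-sound cd

  triples-unique : Unique (triples n)
  triples-unique = concatMap-unique proj₁ _ (Uniqueₚ.allFin⁺ n)
    (λ i → concatMap-unique (proj₁ ∘ proj₂) _ (Uniqueₚ.allFin⁺ n)
      (λ j → concatMap-unique (proj₂ ∘ proj₂) _ (Uniqueₚ.allFin⁺ n)
        (λ k → unique-singleton-if _ _)
        (λ m → cong (proj₂ ∘ proj₂) (proj₂ (∈-singleton-if⁻ _ _ m))))
      (λ m → cong (proj₁ ∘ proj₂) (proj₂ (∈-row⁻ m))))
    (λ m → cong proj₁ (proj₂ (proj₂ (∈-slice⁻ m))))
    where
    ∈-row⁻ : ∀ {i j t} →
      t ∈ concatMap (λ k → if (i <F j) ∧ (j <F k) then (i , j , k) ∷ [] else []) (allFin n) →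
      ∃ λ k → t ≡ (i , j , k)
    ∈-row⁻ m with find (∈-concatMap⁻ _ {xs = allFin n} m)
    ... | k , _ , m′ = k , proj₂ (∈-singleton-if⁻ _ _ m′)
    ∈-slice⁻ : ∀ {i t} →
      t ∈ concatMap (λ j → concatMap (λ k → if (i <F j) ∧ (j <F k) then (i , j , k) ∷ [] else [])
        (allFin n)) (allFin n) →
      ∃ λ j → ∃ λ k → t ≡ (i , j , k)
    ∈-slice⁻ m with find (∈-concatMap⁻ _ {xs = allFin n} m)
    ... | j , _ , m′ = j , ∈-row⁻ m′

forbidden : List ℕ
forbidden = 0 ∷ 1 ∷ 3 ∷ []

allowed : ℕ → Bool
allowed s = not (s ∈ᵇ forbidden)

even₃ : Bool → Bool → Bool → Bool
even₃ x y z = not (x xor y xor z)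

triangle : Bool → Bool → Bool → Bool
triangle x y z = x ∧ y ∧ z

-- The six arguments are the adjacencies ab, ac, ad, bc, bd, cd of four vertices a, b, c, d.
induced2K2 : Bool → Bool → Bool → Bool → Bool → Bool → Bool
induced2K2 ab ac ad bc bd cd =
  (ab ∧ cd ∧ not ac ∧ not ad ∧ not bc ∧ not bd) ∨
  (ac ∧ bd ∧ not ab ∧ not ad ∧ not bc ∧ not cd) ∨
  (ad ∧ bc ∧ not ab ∧ not ac ∧ not bd ∧ not cd)

triangleOr2K2 : Bool → Bool → Bool → Bool → Bool → Bool → Bool
triangleOr2K2 ab ac ad bc bd cd =
  triangle ab ac bc ∨ triangle ab ad bd ∨ triangle ac ad cd ∨ triangle bc bd cd ∨
  induced2K2 ab ac ad bc bd cd

evenCount : Bool → Bool → Bool → Bool → Bool → Bool → ℕ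
evenCount ab ac ad bc bd cd =
  b2n (even₃ ab ac bc) + b2n (even₃ ab ad bd) + b2n (even₃ ac ad cd) + b2n (even₃ bc bd cd)

allowed⇒even₃ : ∀ x y z e → allowed (b2n (not x) + b2n (not y) + b2n (not z) + b2n e) ≡ true →
  e ≡ even₃ x y z
allowed⇒even₃ x y z e = ==-sound ∘ ⇒ᵇ-sound (valid 4 (λ x y z e →
  allowed (b2n (not x) + b2n (not y) + b2n (not z) + b2n e) ⇒ᵇ (e == even₃ x y z)) x y z e)

allowed⇒¬triangle : ∀ x y z → allowed (evenCount false false false x y z) ≡ true → triangle x y z ≡ false
allowed⇒¬triangle x y z = not-true⁻ ∘ ⇒ᵇ-sound (valid 3 (λ x y z →
  allowed (evenCount false false false x y z) ⇒ᵇ not (triangle x y z)) x y z)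

allowed⇒¬induced2K2 : ∀ ab ac ad bc bd cd → allowed (evenCount ab ac ad bc bd cd) ≡ true →
  induced2K2 ab ac ad bc bd cd ≡ false
allowed⇒¬induced2K2 ab ac ad bc bd cd = not-true⁻ ∘ ⇒ᵇ-sound (valid 6 (λ ab ac ad bc bd cd →
  allowed (evenCount ab ac ad bc bd cd) ⇒ᵇ not (induced2K2 ab ac ad bc bd cd)) ab ac ad bc bd cd)

¬triangleOr2K2⇒allowed : ∀ ab ac ad bc bd cd → triangleOr2K2 ab ac ad bc bd cd ≡ false →
  allowed (evenCount ab ac ad bc bd cd) ≡ true
¬triangleOr2K2⇒allowed ab ac ad bc bd cd h = ⇒ᵇ-sound (valid 6 (λ ab ac ad bc bd cd →
  not (triangleOr2K2 ab ac ad bc bd cd) ⇒ᵇ allowed (evenCount ab ac ad bc bd cd)) ab ac ad bc bd cd)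
  (cong not h)

induced2K2-swap₁₂ : ∀ ab ac ad bc bd cd → induced2K2 ab bc bd ac ad cd ≡ induced2K2 ab ac ad bc bd cd
induced2K2-swap₁₂ ab ac ad bc bd cd = ==-sound (valid 6 (λ ab ac ad bc bd cd →
  induced2K2 ab bc bd ac ad cd == induced2K2 ab ac ad bc bd cd) ab ac ad bc bd cd)

induced2K2-swap₂₃ : ∀ ab ac ad bc bd cd → induced2K2 ac ab ad bc cd bd ≡ induced2K2 ab ac ad bc bd cd
induced2K2-swap₂₃ ab ac ad bc bd cd = ==-sound (valid 6 (λ ab ac ad bc bd cd →
  induced2K2 ac ab ad bc cd bd == induced2K2 ab ac ad bc bd cd) ab ac ad bc bd cd)

induced2K2-swap₃₄ : ∀ ab ac ad bc bd cd → induced2K2 ab ad ac bd bc cd ≡ induced2K2 ab ac ad bc bd cd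
induced2K2-swap₃₄ ab ac ad bc bd cd = ==-sound (valid 6 (λ ab ac ad bc bd cd →
  induced2K2 ab ad ac bd bc cd == induced2K2 ab ac ad bc bd cd) ab ac ad bc bd cd)

module _ {n : ℕ} where

  by-sorting₃ : (P : Fin n → Fin n → Fin n → Set) →
    (∀ {a b c} → a <ᶠ b → b <ᶠ c → P a b c) →
    (∀ {a b c} → P a b c → P b a c) → (∀ {a b c} → P a b c → P a c b) →
    ∀ {x y z} → x ≢ y → x ≢ z → y ≢ z → P x y z
  by-sorting₃ P base s₁₂ s₂₃ {x} {y} {z} x≢y x≢z y≢z with Finₚ.<-cmp x y
  ... | tri≈ _ x≡y _ = ⊥-elim (x≢y x≡y)
  ... | tri< xy _ _ with Finₚ.<-cmp y z
  ...   | tri≈ _ y≡z _ = ⊥-elim (y≢z y≡z)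
  ...   | tri< yz _ _ = base xy yz
  ...   | tri> _ _ zy with Finₚ.<-cmp x z
  ...     | tri≈ _ x≡z _ = ⊥-elim (x≢z x≡z)
  ...     | tri< xz _ _ = s₂₃ (base xz zy)
  ...     | tri> _ _ zx = s₂₃ (s₁₂ (base zx xy))
  by-sorting₃ P base s₁₂ s₂₃ {x} {y} {z} x≢y x≢z y≢z | tri> _ _ yx with Finₚ.<-cmp x z
  ...   | tri≈ _ x≡z _ = ⊥-elim (x≢z x≡z)
  ...   | tri< xz _ _ = s₁₂ (base yx xz)
  ...   | tri> _ _ zx with Finₚ.<-cmp y z
  ...     | tri≈ _ y≡z _ = ⊥-elim (y≢z y≡z)
  ...     | tri< yz _ _ = s₁₂ (s₂₃ (base yz zx))
  ...     | tri> _ _ zy = s₁₂ (s₂₃ (s₁₂ (base zy yx)))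

  by-sorting₄ : (P : Fin n → Fin n → Fin n → Fin n → Set) →
    (∀ {a b c d} → a <ᶠ b → b <ᶠ c → c <ᶠ d → P a b c d) →
    (∀ {a b c d} → P a b c d → P b a c d) → (∀ {a b c d} → P a b c d → P a c b d) →
    (∀ {a b c d} → P a b c d → P a b d c) →
    ∀ {x y z w} → x ≢ y → x ≢ z → x ≢ w → y ≢ z → y ≢ w → z ≢ w → P x y z w
  by-sorting₄ P base s₁₂ s₂₃ s₃₄ {x} {y} {z} {w} x≢y x≢z x≢w y≢z y≢w z≢w =
    by-sorting₃ (λ a b c → w ≢ a → w ≢ b → w ≢ c → P a b c w) insert
      (λ h w≢b w≢a w≢c → s₁₂ (h w≢a w≢b w≢c)) (λ h w≢a w≢c w≢b → s₂₃ (h w≢a w≢b w≢c))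
      x≢y x≢z y≢z (x≢w ∘ sym) (y≢w ∘ sym) (z≢w ∘ sym)
    where
    insert : ∀ {a b c} → a <ᶠ b → b <ᶠ c → w ≢ a → w ≢ b → w ≢ c → P a b c w
    insert {a} {b} {c} ab bc w≢a w≢b w≢c with Finₚ.<-cmp w a
    ... | tri≈ _ e _ = ⊥-elim (w≢a e)
    ... | tri< wa _ _ = s₃₄ (s₂₃ (s₁₂ (base wa ab bc)))
    ... | tri> _ _ aw with Finₚ.<-cmp w b
    ...   | tri≈ _ e _ = ⊥-elim (w≢b e)
    ...   | tri< wb _ _ = s₃₄ (s₂₃ (base aw wb bc))
    ...   | tri> _ _ bw with Finₚ.<-cmp w c
    ...     | tri≈ _ e _ = ⊥-elim (w≢c e)
    ...     | tri< wc _ _ = s₃₄ (base ab bw wc)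
    ...     | tri> _ _ cw = base ab bc cw

Graph : ℕ → Set
Graph n = Fin n → Fin n → Bool

module _ {n : ℕ} (K : Graph n) where

  Symmetric : Set
  Symmetric = ∀ x y → K x y ≡ K y x

  Irreflexive : Set
  Irreflexive = ∀ x → K x x ≡ false

  TriangleFree : Set
  TriangleFree = ∀ x y z → K x y ≡ true → K x z ≡ true → K y z ≡ true → ⊥

  Induced2K2Free : Set
  Induced2K2Free = ∀ x y z w → K x y ≡ true → K z w ≡ true →
    K x z ≡ false → K x w ≡ false → K y z ≡ false → K y w ≡ false → ⊥

  evenTriple : Triple n → Bool
  evenTriple (a , b , c) = even₃ (K a b) (K a c) (K b c)

  evenCountOn : Fin n → Fin n → Fin n → Fin n → ℕ
  evenCountOn a b c d = evenCount (K a b) (K a c) (K a d) (K b c) (K b d) (K c d)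
  induced2K2On triangleOr2K2On : Fin n → Fin n → Fin n → Fin n → Bool
  induced2K2On a b c d = induced2K2 (K a b) (K a c) (K a d) (K b c) (K b d) (K c d)
  triangleOr2K2On a b c d = triangleOr2K2 (K a b) (K a c) (K a d) (K b c) (K b d) (K c d)

module _ {n : ℕ} {K : Graph n} (K-sym : Symmetric K) where

  triangleOr2K2On-false : TriangleFree K → Induced2K2Free K → ∀ a b c d → triangleOr2K2On K a b c d ≡ false
  triangleOr2K2On-false tf mf a b c d = ≢true⇒≡false cases
    where
    ¬triangle : ∀ x y z → triangle (K x y) (K x z) (K y z) ≢ true
    ¬triangle x y z h with ∧-true⁻ {K x y} h
    ... | xy , h′ = tf x y z xy (proj₁ (∧-true⁻ h′)) (proj₂ (∧-true⁻ {K x z} h′))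

    ¬matching : ∀ x y z w → (K x y ∧ K z w ∧ not (K x z) ∧ not (K x w) ∧ not (K y z) ∧ not (K y w)) ≢ true
    ¬matching x y z w h with ∧-true⁻ {K x y} h
    ... | xy , h with ∧-true⁻ {K z w} h
    ... | zw , h with ∧-true⁻ {not (K x z)} h
    ... | xz , h with ∧-true⁻ {not (K x w)} h
    ... | xw , h with ∧-true⁻ {not (K y z)} h
    ... | yz , yw = mf x y z w xy zw (not-true⁻ xz) (not-true⁻ xw) (not-true⁻ yz) (not-true⁻ yw)

    cases : triangleOr2K2On K a b c d ≢ true
    cases h with ∨-true⁻ {triangle (K a b) (K a c) (K b c)} h
    ... | inj₁ t = ¬triangle a b c t
    ... | inj₂ h with ∨-true⁻ {triangle (K a b) (K a d) (K b d)} h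
    ... | inj₁ t = ¬triangle a b d t
    ... | inj₂ h with ∨-true⁻ {triangle (K a c) (K a d) (K c d)} h
    ... | inj₁ t = ¬triangle a c d t
    ... | inj₂ h with ∨-true⁻ {triangle (K b c) (K b d) (K c d)} h
    ... | inj₁ t = ¬triangle b c d t
    ... | inj₂ h with ∨-true⁻ {K a b ∧ K c d ∧ not (K a c) ∧ not (K a d) ∧ not (K b c) ∧ not (K b d)} h
    ... | inj₁ p = ¬matching a b c d p
    ... | inj₂ h with ∨-true⁻ {K a c ∧ K b d ∧ not (K a b) ∧ not (K a d) ∧ not (K b c) ∧ not (K c d)} h
    ... | inj₁ p rewrite K-sym b c = ¬matching a c b d p
    ... | inj₂ p rewrite K-sym b d | K-sym c d = ¬matching a d b c p

  module _ (K-irr : Irreflexive K) where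

    adjacent⇒≢ : ∀ {x y} → K x y ≡ true → x ≢ y
    adjacent⇒≢ {x} xy refl = true≢false (trans (sym xy) (K-irr x))

    triangleFree-by-sorting :
      (∀ {a b c} → a <ᶠ b → b <ᶠ c → triangle (K a b) (K a c) (K b c) ≡ false) → TriangleFree K
    triangleFree-by-sorting sorted x y z xy xz yz =
      by-sorting₃ P (λ ab bc → base (sorted ab bc))
        (λ {a} {b} h ab bc ac → h (trans (K-sym a b) ab) ac bc)
        (λ {a} {b} {c} h ac ab cb → h ab ac (trans (K-sym b c) cb))
        (adjacent⇒≢ xy) (adjacent⇒≢ xz) (adjacent⇒≢ yz) xy xz yz
      where
      P : Fin n → Fin n → Fin n → Set
      P a b c = K a b ≡ true → K a c ≡ true → K b c ≡ true → ⊥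
      base : ∀ {a b c} → triangle (K a b) (K a c) (K b c) ≡ false → P a b c
      base t ab ac bc = true≢false (trans (sym (cong₂ _∧_ ab (cong₂ _∧_ ac bc))) t)

    induced2K2Free-by-sorting :
      (∀ {a b c d} → a <ᶠ b → b <ᶠ c → c <ᶠ d → induced2K2On K a b c d ≡ false) → Induced2K2Free K
    induced2K2Free-by-sorting sorted x y z w xy zw xz xw yz yw =
      true≢false (trans (sym matched)
        (by-sorting₄ (λ a b c d → induced2K2On K a b c d ≡ false) sorted
          (λ {a} {b} {c} {d} → trans (swap₁₂ a b c d)) (λ {a} {b} {c} {d} → trans (swap₂₃ a b c d))
          (λ {a} {b} {c} {d} → trans (swap₃₄ a b c d))
          (adjacent⇒≢ xy) (λ { refl → true≢false (trans (sym zw) xw) })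
          (λ { refl → true≢false (trans (sym zw) (trans (K-sym z x) xz)) })
          (λ { refl → true≢false (trans (sym zw) yw) })
          (λ { refl → true≢false (trans (sym zw) (trans (K-sym z y) yz)) }) (adjacent⇒≢ zw)))
      where
      matched : induced2K2On K x y z w ≡ true
      matched rewrite xy | zw | xz | xw | yz | yw = refl
      swap₁₂ : ∀ a b c d → induced2K2On K b a c d ≡ induced2K2On K a b c d
      swap₁₂ a b c d rewrite K-sym b a = induced2K2-swap₁₂ (K a b) (K a c) (K a d) (K b c) (K b d) (K c d)
      swap₂₃ : ∀ a b c d → induced2K2On K a c b d ≡ induced2K2On K a b c d
      swap₂₃ a b c d rewrite K-sym c b = induced2K2-swap₂₃ (K a b) (K a c) (K a d) (K b c) (K b d) (K c d)
      swap₃₄ : ∀ a b c d → induced2K2On K a b d c ≡ induced2K2On K a b c d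
      swap₃₄ a b c d rewrite K-sym d c = induced2K2-swap₃₄ (K a b) (K a c) (K a d) (K b c) (K b d) (K c d)

-- Hypergraphs of even triples

admissible-allowed : ∀ {n} {H : Hypergraph n} → admissible forbidden H ≡ true →
  ∀ {q} → q ∈ quads n → allowed (spanned H q) ≡ true
admissible-allowed {H = H} adm = all-true⁻ (λ q → allowed (spanned H q)) adm

module _ {n : ℕ} (K : Graph n) where

  IsEvenHypergraph : Hypergraph n → Set
  IsEvenHypergraph H = ∀ {t} → t ∈ triples n → isEdge H t ≡ evenTriple K t

  spanned-even : ∀ {H} → IsEvenHypergraph H → ∀ {a b c d} → a <ᶠ b → b <ᶠ c → c <ᶠ d →
    spanned H (a , b , c , d) ≡ evenCountOn K a b c d
  spanned-even ev ab bc cd =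
    cong₂ _+_ (cong₂ _+_ (cong₂ _+_ (cong b2n (ev (∈-triples⁺ ab bc)))
                                     (cong b2n (ev (∈-triples⁺ ab (<-trans bc cd)))))
                          (cong b2n (ev (∈-triples⁺ (<-trans ab bc) cd))))
              (cong b2n (ev (∈-triples⁺ bc cd)))

  evenHypergraph : Hypergraph n
  evenHypergraph = boolFilter (evenTriple K) (triples n)

  evenHypergraph-even : IsEvenHypergraph evenHypergraph
  evenHypergraph-even = isEdge-boolFilter (evenTriple K)

  evenHypergraph-admissible : Symmetric K → TriangleFree K → Induced2K2Free K →
    admissible forbidden evenHypergraph ≡ true
  evenHypergraph-admissible K-sym tf mf = all-true⁺ _ (quads n) allowed-at
    where
    allowed-at : ∀ {q} → q ∈ quads n → allowed (spanned evenHypergraph q) ≡ true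
    allowed-at {a , b , c , d} m =
      subst (λ s → allowed s ≡ true) (sym (spanned-even {evenHypergraph} evenHypergraph-even ab bc cd))
        (¬triangleOr2K2⇒allowed (K a b) (K a c) (K a d) (K b c) (K b d) (K c d)
          (triangleOr2K2On-false K-sym tf mf a b c d))
      where
      ab = proj₁ (∈-quads⁻ m)
      bc = proj₁ (proj₂ (∈-quads⁻ m))
      cd = proj₂ (proj₂ (∈-quads⁻ m))

evenHypergraph-determined : ∀ {n} {K K′ : Graph n} {H H′} →
  H ∈ sublists (triples n) → H′ ∈ sublists (triples n) →
  IsEvenHypergraph K H → IsEvenHypergraph K′ H′ → (∀ x y → K x y ≡ K′ x y) → H ≡ H′
evenHypergraph-determined {n} {K} {K′} {H} {H′} s s′ ev ev′ K≡K′ =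
  sublists-extensional (triples n) triples-unique s s′
    (λ t∈H → isEdge-sound H′ (trans (sym (same (sublists-⊆ _ s t∈H))) (isEdge-complete H t∈H)))
    (λ t∈H′ → isEdge-sound H (trans (same (sublists-⊆ _ s′ t∈H′)) (isEdge-complete H′ t∈H′)))
  where
  evenTriple-cong : ∀ t → evenTriple K t ≡ evenTriple K′ t
  evenTriple-cong (a , b , c) rewrite K≡K′ a b | K≡K′ a c | K≡K′ b c = refl
  same : ∀ {t} → t ∈ triples n → isEdge H t ≡ isEdge H′ t
  same {t} m = trans (ev m) (trans (evenTriple-cong t) (sym (ev′ m)))

-- The complement of the link of vertex 0

module _ {m : ℕ} (H : Hypergraph (suc m)) where
  private
    lo hi : Fin (suc m) → Fin (suc m) → Fin (suc m)
    lo x y = if x <F y then x else y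
    hi x y = if x <F y then y else x

  coLink : Graph (suc m)
  coLink Fin.zero y = false
  coLink (Fin.suc i) Fin.zero = false
  coLink x@(Fin.suc _) y@(Fin.suc _) = not (x =F y) ∧ not (isEdge H (Fin.zero , lo x y , hi x y))

  coLink-symmetric : Symmetric coLink
  coLink-symmetric Fin.zero Fin.zero = refl
  coLink-symmetric Fin.zero (Fin.suc j) = refl
  coLink-symmetric (Fin.suc i) Fin.zero = refl
  coLink-symmetric x@(Fin.suc _) y@(Fin.suc _) with Finₚ.<-cmp x y
  ... | tri≈ _ refl _ = refl
  ... | tri< x<y _ _ rewrite <F-true {a = x} {y} x<y | <F-false {a = y} {x} x<y
        | =F-false (Finₚ.<⇒≢ x<y) | =F-false (Finₚ.<⇒≢ x<y ∘ sym) = refl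
  ... | tri> _ _ y<x rewrite <F-true {a = y} {x} y<x | <F-false {a = x} {y} y<x
        | =F-false (Finₚ.<⇒≢ y<x) | =F-false (Finₚ.<⇒≢ y<x ∘ sym) = refl

  coLink-irreflexive : Irreflexive coLink
  coLink-irreflexive Fin.zero = refl
  coLink-irreflexive x@(Fin.suc _) rewrite =F-refl x = refl

  coLink-edge : ∀ {i j} → Fin.suc i <ᶠ Fin.suc j →
    isEdge H (Fin.zero , Fin.suc i , Fin.suc j) ≡ not (coLink (Fin.suc i) (Fin.suc j))
  coLink-edge {i} {j} lt rewrite <F-true {a = Fin.suc i} {Fin.suc j} lt | =F-false (Finₚ.<⇒≢ lt) =
    sym (not-involutive _)

  module _ (adm : admissible forbidden H ≡ true) where

    coLink-even : IsEvenHypergraph coLink H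
    coLink-even {Fin.zero , Fin.zero , _} m = ⊥-elim (<-irrefl refl (proj₁ (∈-triples⁻ m)))
    coLink-even {Fin.zero , Fin.suc _ , Fin.zero} m = ⊥-elim (<-asym (proj₂ (∈-triples⁻ m)) z<s)
    coLink-even {Fin.zero , Fin.suc _ , Fin.suc _} m = coLink-edge (proj₂ (∈-triples⁻ m))
    coLink-even {Fin.suc _ , Fin.zero , _} m = ⊥-elim (<-asym (proj₁ (∈-triples⁻ m)) z<s)
    coLink-even {Fin.suc _ , Fin.suc _ , Fin.zero} m = ⊥-elim (<-asym (proj₂ (∈-triples⁻ m)) z<s)
    coLink-even {a@(Fin.suc _) , b@(Fin.suc _) , c@(Fin.suc _)} m =
      allowed⇒even₃ (coLink a b) (coLink a c) (coLink b c) (isEdge H (a , b , c))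
        (subst (λ s → allowed s ≡ true) spans (admissible-allowed {H = H} adm (∈-quads⁺ z<s ab bc)))
      where
      ab = proj₁ (∈-triples⁻ m)
      bc = proj₂ (∈-triples⁻ m)
      spans : spanned H (Fin.zero , a , b , c) ≡
        b2n (not (coLink a b)) + b2n (not (coLink a c)) + b2n (not (coLink b c)) + b2n (isEdge H (a , b , c))
      spans = cong₂ _+_ (cong₂ _+_ (cong₂ _+_ (cong b2n (coLink-edge ab))
                                             (cong b2n (coLink-edge (<-trans ab bc))))
                                   (cong b2n (coLink-edge bc))) refl

    allowed-on-increasing : ∀ {a b c d} → a <ᶠ b → b <ᶠ c → c <ᶠ d →
      allowed (evenCountOn coLink a b c d) ≡ true
    allowed-on-increasing ab bc cd =
      subst (λ s → allowed s ≡ true) (spanned-even coLink {H} coLink-even ab bc cd)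
        (admissible-allowed {H = H} adm (∈-quads⁺ ab bc cd))

    coLink-triangleFree : TriangleFree coLink
    coLink-triangleFree = triangleFree-by-sorting coLink-symmetric coLink-irreflexive sorted
      where
      sorted : ∀ {a b c} → a <ᶠ b → b <ᶠ c → triangle (coLink a b) (coLink a c) (coLink b c) ≡ false
      sorted {Fin.zero} ab bc = refl
      sorted {a@(Fin.suc _)} {b} {c} ab bc =
        allowed⇒¬triangle (coLink a b) (coLink a c) (coLink b c) (allowed-on-increasing z<s ab bc)

    coLink-induced2K2Free : Induced2K2Free coLink
    coLink-induced2K2Free = induced2K2Free-by-sorting coLink-symmetric coLink-irreflexive sorted
      where
      sorted : ∀ {a b c d} → a <ᶠ b → b <ᶠ c → c <ᶠ d → induced2K2On coLink a b c d ≡ false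
      sorted {a} {b} {c} {d} ab bc cd = allowed⇒¬induced2K2 (coLink a b) (coLink a c) (coLink a d)
        (coLink b c) (coLink b d) (coLink c d) (allowed-on-increasing ab bc cd)

b2n≤1 : ∀ b → b2n b ≤ 1
b2n≤1 true = ≤-refl
b2n≤1 false = z≤n

count : ∀ {n} → (Fin n → Bool) → ℕ
count {zero} p = 0
count {suc n} p = b2n (p Fin.zero) + count (p ∘ Fin.suc)

count≤ : ∀ {n} (p : Fin n → Bool) → count p ≤ n
count≤ {zero} p = z≤n
count≤ {suc n} p = +-mono-≤ (b2n≤1 (p Fin.zero)) (count≤ (p ∘ Fin.suc))

count-mono : ∀ {n} {p q : Fin n → Bool} → (∀ i → p i ≡ true → q i ≡ true) → count p ≤ count q
count-mono {zero} h = z≤n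
count-mono {suc n} {p} {q} h with p Fin.zero in p₀ | q Fin.zero in q₀
... | true | true = s≤s (count-mono (h ∘ Fin.suc))
... | true | false = ⊥-elim (true≢false (trans (sym (h Fin.zero p₀)) q₀))
... | false | true = m≤n⇒m≤1+n (count-mono (h ∘ Fin.suc))
... | false | false = count-mono (h ∘ Fin.suc)

count-mono-< : ∀ {n} {p q : Fin n → Bool} → (∀ i → p i ≡ true → q i ≡ true) →
  ∀ i → p i ≡ false → q i ≡ true → count p < count q
count-mono-< {suc n} h Fin.zero pᵢ qᵢ rewrite pᵢ | qᵢ = s≤s (count-mono (h ∘ Fin.suc))
count-mono-< {suc n} {p} {q} h (Fin.suc i) pᵢ qᵢ with p Fin.zero in p₀ | q Fin.zero in q₀
... | true | true = s≤s (count-mono-< (h ∘ Fin.suc) i pᵢ qᵢ)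
... | true | false = ⊥-elim (true≢false (trans (sym (h Fin.zero p₀)) q₀))
... | false | true = m<n⇒m<1+n (count-mono-< (h ∘ Fin.suc) i pᵢ qᵢ)
... | false | false = count-mono-< (h ∘ Fin.suc) i pᵢ qᵢ

-- min { g z ∣ p z }, or d when no z satisfies p.
minimumOf : ∀ {n} → (Fin n → Bool) → (Fin n → ℕ) → ℕ → ℕ
minimumOf {zero} p g d = d
minimumOf {suc n} p g d =
  if p Fin.zero then g Fin.zero ⊓ minimumOf (p ∘ Fin.suc) (g ∘ Fin.suc) d
  else minimumOf (p ∘ Fin.suc) (g ∘ Fin.suc) d

minimumOf≤default : ∀ {n} p g d → minimumOf {n} p g d ≤ d
minimumOf≤default {zero} p g d = ≤-refl
minimumOf≤default {suc n} p g d with p Fin.zero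
... | true = ≤-trans (m⊓n≤n _ _) (minimumOf≤default (p ∘ Fin.suc) (g ∘ Fin.suc) d)
... | false = minimumOf≤default (p ∘ Fin.suc) (g ∘ Fin.suc) d

minimumOf≤ : ∀ {n} p g d {z} → p z ≡ true → minimumOf {n} p g d ≤ g z
minimumOf≤ {suc n} p g d {Fin.zero} pz rewrite pz = m⊓n≤m _ _
minimumOf≤ {suc n} p g d {Fin.suc z} pz with p Fin.zero
... | true = ≤-trans (m⊓n≤n _ _) (minimumOf≤ (p ∘ Fin.suc) (g ∘ Fin.suc) d pz)
... | false = minimumOf≤ (p ∘ Fin.suc) (g ∘ Fin.suc) d pz

minimumOf-attained : ∀ {n} p g d {t} → minimumOf {n} p g d ≤ t → t < d → ∃ λ z → p z ≡ true × g z ≤ t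
minimumOf-attained {zero} p g d le lt = ⊥-elim (<-irrefl refl (≤-<-trans le lt))
minimumOf-attained {suc n} p g d le lt with p Fin.zero in p₀
... | false = Σ-map Fin.suc id (minimumOf-attained (p ∘ Fin.suc) (g ∘ Fin.suc) d le lt)
... | true with ⊓-sel (g Fin.zero) (minimumOf (p ∘ Fin.suc) (g ∘ Fin.suc) d)
...   | inj₁ eq = Fin.zero , p₀ , subst (_≤ _) eq le
...   | inj₂ eq = Σ-map Fin.suc id (minimumOf-attained (p ∘ Fin.suc) (g ∘ Fin.suc) d (subst (_≤ _) eq le) lt)

-- Triangle-free graphs without induced 2K2

Part : Set
Part = Fin 3

record Labelling {n} (K : Graph n) : Set where
  field
    part       : Fin n → Part
    degree     : Fin n → Part → ℕ
    threshold  : Fin n → Part → ℕ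
    degree≤    : ∀ x P → degree x P ≤ n
    threshold≤ : ∀ x P → threshold x P ≤ suc n
    adjacency  : ∀ x y → K x y ≡ not (part x =F part y) ∧ (threshold x (part y) ≤ᵇ degree y (part x))

module _ {n} {K : Graph n} (K-sym : Symmetric K) (tf : TriangleFree K) (mf : Induced2K2Free K) where

  module SplitAlong {u v : Fin n} (uv : K u v ≡ true) where

    side : Fin n → Part
    side x = if K v x then # 0 else if K u x then # 1 else # 2

    same-side⇒¬adjacent : ∀ {x y} → side x ≡ side y → K x y ≡ false
    same-side⇒¬adjacent {x} {y} eq with K x y in xy | K v x in vx | K v y in vy | K u x in ux | K u y in uy
    ... | false | _ | _ | _ | _ = refl
    ... | true | true | true | _ | _ = ⊥-elim (tf v x y vx vy xy)
    ... | true | false | false | true | true = ⊥-elim (tf u x y ux uy xy)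
    ... | true | false | false | false | false =
      ⊥-elim (mf x y u v xy uv (trans (K-sym x u) ux) (trans (K-sym x v) vx)
                               (trans (K-sym y u) uy) (trans (K-sym y v) vy))
    same-side⇒¬adjacent () | true | true | false | _ | true
    same-side⇒¬adjacent () | true | true | false | _ | false
    same-side⇒¬adjacent () | true | false | true | true | _
    same-side⇒¬adjacent () | true | false | true | false | _
    same-side⇒¬adjacent () | true | false | false | true | false
    same-side⇒¬adjacent () | true | false | false | false | true

    neighbourIn : Part → Fin n → Fin n → Bool
    neighbourIn P y z = K y z ∧ (side z =F P)

    neighbourIn⁻ : ∀ {P y z} → neighbourIn P y z ≡ true → K y z ≡ true × side z ≡ P
    neighbourIn⁻ {P} {y} {z} h = proj₁ (∧-true⁻ {K y z} h) , =F-sound {i = side z} {P} (proj₂ (∧-true⁻ {K y z} h))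

    degree : Fin n → Part → ℕ
    degree y P = count (neighbourIn P y)

    threshold : Fin n → Part → ℕ
    threshold x Q = minimumOf (neighbourIn Q x) (λ z → degree z (side x)) (suc n)

    -- If x ∈ N(z) ∖ N(y) then N(y) ∩ side x ⊆ N(z): between two sides, neighbourhoods are nested.
    nested : ∀ {x y z x′} → K z x ≡ true → K x y ≡ false → side z ≡ side y →
      K y x′ ≡ true → side x′ ≡ side x → K z x′ ≡ true
    nested {x} {y} {z} {x′} zx xy zy yx′ x′x with K z x′ in zx′
    ... | true = refl
    ... | false = ⊥-elim (mf z x y x′ zx yx′ (same-side⇒¬adjacent zy) zx′ xy (same-side⇒¬adjacent (sym x′x)))

    threshold≤degree⇒adjacent : ∀ {x y} → threshold x (side y) ≤ degree y (side x) → K x y ≡ true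
    threshold≤degree⇒adjacent {x} {y} le with K x y in xy
    ... | true = refl
    ... | false = ⊥-elim (<⇒≱ degree-y<degree-z dz≤dy)
      where
      P = side x
      witness = minimumOf-attained (neighbourIn (side y) x) (λ z → degree z P) (suc n) le
        (s≤s (count≤ (neighbourIn P y)))
      z = proj₁ witness
      dz≤dy = proj₂ (proj₂ witness)
      zx = trans (K-sym z x) (proj₁ (neighbourIn⁻ (proj₁ (proj₂ witness))))
      zy = proj₂ (neighbourIn⁻ (proj₁ (proj₂ witness)))
      degree-y<degree-z : degree y P < degree z P
      degree-y<degree-z = count-mono-< {p = neighbourIn P y} {q = neighbourIn P z}
        (λ x′ h → ∧-true⁺ (nested zx xy zy (proj₁ (neighbourIn⁻ h)) (proj₂ (neighbourIn⁻ h)))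
                          (proj₂ (∧-true⁻ {K y x′} h)))
        x (cong (_∧ (side x =F P)) (trans (K-sym y x) xy)) (∧-true⁺ zx (=F-refl P))

    adjacency : ∀ x y → K x y ≡ not (side x =F side y) ∧ (threshold x (side y) ≤ᵇ degree y (side x))
    adjacency x y with side x =F side y in same
    ... | true = same-side⇒¬adjacent (=F-sound {i = side x} {side y} same)
    ... | false with K x y in xy
    ...   | true = sym (T⇒≡true (≤⇒≤ᵇ (minimumOf≤ (neighbourIn (side y) x) (λ z → degree z (side x)) (suc n)
                      (∧-true⁺ xy (=F-refl (side y))))))
    ...   | false = sym (≢true⇒≡false λ le →
                true≢false (trans (sym (threshold≤degree⇒adjacent (≤ᵇ⇒≤ _ _ (≡true⇒T le)))) xy))

    labelling : Labelling K
    labelling = record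
      { part = side ; degree = degree ; threshold = threshold
      ; degree≤ = λ y P → count≤ (neighbourIn P y)
      ; threshold≤ = λ x Q → minimumOf≤default (neighbourIn Q x) (λ z → degree z (side x)) (suc n)
      ; adjacency = adjacency }

  labelling : Labelling K
  labelling with Finₚ.any? (λ u → Finₚ.any? (λ v → K u v ≟ᵇ true))
  ... | yes (u , v , uv) = SplitAlong.labelling uv
  ... | no no-edge = record
    { part = λ _ → # 0 ; degree = λ _ _ → 0 ; threshold = λ _ _ → 0
    ; degree≤ = λ _ _ → z≤n ; threshold≤ = λ _ _ → z≤n
    ; adjacency = λ x y → ≢true⇒≡false (λ xy → no-edge (x , y , xy)) }

#Labels : ℕ → ℕ
#Labels n = 3 * (suc n ^ 3 * suc (suc n) ^ 3)

funToFin-injective : ∀ {a b} {f g : Fin a → Fin b} → funToFin f ≡ funToFin g → ∀ i → f i ≡ g i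
funToFin-injective {f = f} {g} e i =
  trans (sym (Finₚ.finToFun-funToFin f i)) (trans (cong (λ c → finToFun c i) e) (Finₚ.finToFun-funToFin g i))

module _ {n} {K : Graph n} (ℓ : Labelling K) where
  open Labelling ℓ

  degreeFin : Fin n → Part → Fin (suc n)
  degreeFin x P = fromℕ< (s≤s (degree≤ x P))

  thresholdFin : Fin n → Part → Fin (suc (suc n))
  thresholdFin x P = fromℕ< (s≤s (threshold≤ x P))

  labelCode : Fin n → Fin (#Labels n)
  labelCode x = combine (part x) (combine (funToFin (degreeFin x)) (funToFin (thresholdFin x)))

  graphCode : Fin (#Labels n ^ n)
  graphCode = funToFin labelCode

graphCode-injective : ∀ {n} {K K′ : Graph n} (ℓ : Labelling K) (ℓ′ : Labelling K′) →
  graphCode ℓ ≡ graphCode ℓ′ → ∀ x y → K x y ≡ K′ x y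
graphCode-injective ℓ ℓ′ e x y = trans (adjacency ℓ x y) (trans labels-agree (sym (adjacency ℓ′ x y)))
  where
  open Labelling
  split : ∀ x → part ℓ x ≡ part ℓ′ x ×
    combine (funToFin (degreeFin ℓ x)) (funToFin (thresholdFin ℓ x)) ≡
    combine (funToFin (degreeFin ℓ′ x)) (funToFin (thresholdFin ℓ′ x))
  split x = Finₚ.combine-injective (part ℓ x) _ (part ℓ′ x) _
    (funToFin-injective {f = labelCode ℓ} {labelCode ℓ′} e x)
  split′ : ∀ x → funToFin (degreeFin ℓ x) ≡ funToFin (degreeFin ℓ′ x) ×
                 funToFin (thresholdFin ℓ x) ≡ funToFin (thresholdFin ℓ′ x)
  split′ x = Finₚ.combine-injective (funToFin (degreeFin ℓ x)) (funToFin (thresholdFin ℓ x))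
    (funToFin (degreeFin ℓ′ x)) (funToFin (thresholdFin ℓ′ x)) (proj₂ (split x))
  degree≡ : ∀ x P → degree ℓ x P ≡ degree ℓ′ x P
  degree≡ x P = Finₚ.fromℕ<-injective (degree ℓ x P) (degree ℓ′ x P) _ _
    (funToFin-injective {f = degreeFin ℓ x} {degreeFin ℓ′ x} (proj₁ (split′ x)) P)
  threshold≡ : ∀ x P → threshold ℓ x P ≡ threshold ℓ′ x P
  threshold≡ x P = Finₚ.fromℕ<-injective (threshold ℓ x P) (threshold ℓ′ x P) _ _
    (funToFin-injective {f = thresholdFin ℓ x} {thresholdFin ℓ′ x} (proj₂ (split′ x)) P)
  labels-agree : not (part ℓ x =F part ℓ y) ∧ (threshold ℓ x (part ℓ y) ≤ᵇ degree ℓ y (part ℓ x)) ≡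
                 not (part ℓ′ x =F part ℓ′ y) ∧ (threshold ℓ′ x (part ℓ′ y) ≤ᵇ degree ℓ′ y (part ℓ′ x))
  labels-agree rewrite proj₁ (split x) | proj₁ (split y) | degree≡ y (part ℓ′ x) | threshold≡ x (part ℓ′ y) =
    refl

-- Chain graphs

three-distinct-Bools : ∀ {a b c : Bool} → a ≢ b → a ≢ c → b ≢ c → ⊥
three-distinct-Bools {true} {true} ab _ _ = ab refl
three-distinct-Bools {true} {false} {true} _ ac _ = ac refl
three-distinct-Bools {true} {false} {false} _ _ bc = bc refl
three-distinct-Bools {false} {true} {true} _ _ bc = bc refl
three-distinct-Bools {false} {true} {false} _ ac _ = ac refl
three-distinct-Bools {false} {false} ab _ _ = ab refl

-- The bipartite graph in which 1 + i ∈ {1, …, k} is joined to k + j ∈ {k + 1, k + 2, …} iff j ≤ G i.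
module Chain (k : ℕ) (G : ℕ → ℕ) where

  inA : ℕ → Bool
  inA x = (1 ≤ᵇ x) ∧ (x ≤ᵇ k)

  joins : ℕ → ℕ → Bool
  joins x y = inA x ∧ (k <ᵇ y) ∧ (y ∸ k ≤ᵇ G (x ∸ 1))

  chainGraph : ∀ {n} → Graph n
  chainGraph x y = joins (toℕ x) (toℕ y) ∨ joins (toℕ y) (toℕ x)

  chainGraph-symmetric : ∀ {n} → Symmetric (chainGraph {n})
  chainGraph-symmetric x y = ∨-comm (joins (toℕ x) (toℕ y)) _

  inB⇒¬inA : ∀ y → (k <ᵇ y) ≡ true → inA y ≡ false
  inB⇒¬inA y y∈B = ≢true⇒≡false λ y∈A →
    <⇒≱ (<ᵇ⇒< k y (≡true⇒T y∈B)) (≤ᵇ⇒≤ y k (≡true⇒T (proj₂ (∧-true⁻ {1 ≤ᵇ y} y∈A))))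

  joins⁻ : ∀ x y → joins x y ≡ true → inA x ≡ true × (k <ᵇ y) ≡ true × y ∸ k ≤ G (x ∸ 1)
  joins⁻ x y h with ∧-true⁻ {inA x} h
  ... | x∈A , h′ with ∧-true⁻ {k <ᵇ y} h′
  ... | y∈B , le = x∈A , y∈B , ≤ᵇ⇒≤ _ _ (≡true⇒T le)

  ¬joins⁻ : ∀ x y → inA x ≡ true → (k <ᵇ y) ≡ true → joins x y ≡ false → G (x ∸ 1) < y ∸ k
  ¬joins⁻ x y x∈A y∈B h = ≰⇒> λ le → true≢false
    (trans (sym (T⇒≡true (≤⇒≤ᵇ le))) (trans (sym (cong₂ (λ a b → a ∧ b ∧ (y ∸ k ≤ᵇ G (x ∸ 1))) x∈A y∈B)) h))

  joins⇒sides-differ : ∀ x y → joins x y ≡ true → inA x ≢ inA y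
  joins⇒sides-differ x y h e with joins⁻ x y h
  ... | x∈A , y∈B , _ = true≢false (trans (sym x∈A) (trans e (inB⇒¬inA y y∈B)))

  adjacent⇒sides-differ : ∀ {n} (x y : Fin n) → chainGraph x y ≡ true → inA (toℕ x) ≢ inA (toℕ y)
  adjacent⇒sides-differ x y h with ∨-true⁻ {joins (toℕ x) (toℕ y)} h
  ... | inj₁ xy = joins⇒sides-differ (toℕ x) (toℕ y) xy
  ... | inj₂ yx = joins⇒sides-differ (toℕ y) (toℕ x) yx ∘ sym

  chainGraph-triangleFree : ∀ {n} → TriangleFree (chainGraph {n})
  chainGraph-triangleFree x y z xy xz yz = three-distinct-Bools
    (adjacent⇒sides-differ x y xy) (adjacent⇒sides-differ x z xz) (adjacent⇒sides-differ y z yz)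

  -- The neighbourhoods of vertices of A are initial segments of B, so they are nested.
  crossing-joins : ∀ a₁ b₁ a₂ b₂ → joins a₁ b₁ ≡ true → joins a₂ b₂ ≡ true →
    joins a₁ b₂ ≡ false → joins a₂ b₁ ≡ false → ⊥
  crossing-joins a₁ b₁ a₂ b₂ j₁ j₂ n₁₂ n₂₁ with joins⁻ a₁ b₁ j₁ | joins⁻ a₂ b₂ j₂
  ... | a₁∈A , b₁∈B , le₁ | a₂∈A , b₂∈B , le₂ = <-irrefl refl
    (≤-<-trans le₁ (<-trans (¬joins⁻ a₁ b₂ a₁∈A b₂∈B n₁₂) (≤-<-trans le₂ (¬joins⁻ a₂ b₁ a₂∈A b₁∈B n₂₁))))

  chainGraph-induced2K2Free : ∀ {n} → Induced2K2Free (chainGraph {n})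
  chainGraph-induced2K2Free x y z w xy zw xz xw yz yw
    with ∨-true⁻ {joins (toℕ x) (toℕ y)} xy | ∨-true⁻ {joins (toℕ z) (toℕ w)} zw
       | ∨-false⁻ {joins (toℕ x) (toℕ z)} xz | ∨-false⁻ {joins (toℕ x) (toℕ w)} xw
       | ∨-false⁻ {joins (toℕ y) (toℕ z)} yz | ∨-false⁻ {joins (toℕ y) (toℕ w)} yw
  ... | inj₁ p | inj₁ q | _ | xw′ , _ | _ , zy′ | _ =
    crossing-joins (toℕ x) (toℕ y) (toℕ z) (toℕ w) p q xw′ zy′
  ... | inj₁ p | inj₂ q | xz′ , _ | _ | _ | _ , wy′ =
    crossing-joins (toℕ x) (toℕ y) (toℕ w) (toℕ z) p q xz′ wy′
  ... | inj₂ p | inj₁ q | _ , zx′ | _ | _ | yw′ , _ =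
    crossing-joins (toℕ y) (toℕ x) (toℕ z) (toℕ w) p q yw′ zx′
  ... | inj₂ p | inj₂ q | _ | _ , wx′ | yz′ , _ | _ =
    crossing-joins (toℕ y) (toℕ x) (toℕ w) (toℕ z) p q yz′ wx′

  chainGraph-zero : ∀ {m} (y : Fin (suc m)) → chainGraph Fin.zero y ≡ false
  chainGraph-zero y rewrite ≢true⇒≡false {k <ᵇ 0} (n≮0 ∘ <ᵇ⇒< k 0 ∘ ≡true⇒T) = ∧-zeroʳ (inA (toℕ y))

  chainGraph-AB : ∀ {n} {x y : Fin n} {i j} → toℕ x ≡ suc i → toℕ y ≡ k + j → i < k → 1 ≤ j →
    chainGraph x y ≡ (j ≤ᵇ G i)
  chainGraph-AB {x = x} {y} {i} {j} x≡ y≡ i<k 1≤j rewrite x≡ | y≡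
    | T⇒≡true (≤⇒≤ᵇ i<k) | T⇒≡true (<⇒<ᵇ (m<m+n k 1≤j)) | m+n∸m≡n k j
    | inB⇒¬inA (k + j) (T⇒≡true (<⇒<ᵇ (m<m+n k 1≤j))) = ∨-identityʳ (j ≤ᵇ G i)

-- Counting admissible hypergraphs

coLink-labelling : ∀ {m} (H : Hypergraph (suc m)) → admissible forbidden H ≡ true → Labelling (coLink H)
coLink-labelling H adm =
  labelling (coLink-symmetric H) (coLink-triangleFree H adm) (coLink-induced2K2Free H adm)

admissible? : ∀ {n} (H : Hypergraph n) → Dec (admissible forbidden H ≡ true)
admissible? H = admissible forbidden H ≟ᵇ true

f≤#Labels^n : ∀ m → f (suc m) forbidden ≤ #Labels (suc m) ^ suc m
f≤#Labels^n m =
  unique-length≤ (Uniqueₚ.filter⁺ admissible? (sublists-unique (triples (suc m)) triples-unique))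
    code code-injective
  where
  Admissibles = filter admissible? (allHypergraphs (suc m))
  member : ∀ {H} → H ∈ Admissibles → H ∈ sublists (triples (suc m)) × admissible forbidden H ≡ true
  member = ∈-filter⁻ admissible? {xs = allHypergraphs (suc m)}
  code : ∀ {H} → H ∈ Admissibles → Fin (#Labels (suc m) ^ suc m)
  code {H} h = graphCode (coLink-labelling H (proj₂ (member h)))
  code-injective : ∀ {H H′} (h : H ∈ Admissibles) (h′ : H′ ∈ Admissibles) → code h ≡ code h′ → H ≡ H′
  code-injective {H} {H′} h h′ e =
    evenHypergraph-determined (proj₁ (member h)) (proj₁ (member h′))
      (coLink-even H (proj₂ (member h))) (coLink-even H′ (proj₂ (member h′)))
      (graphCode-injective (coLink-labelling H (proj₂ (member h)))
                           (coLink-labelling H′ (proj₂ (member h′))) e)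


thresholds : ∀ {k} → (Fin k → Fin (suc k)) → ℕ → ℕ
thresholds {k} g i with i <? k
... | yes i<k = toℕ (g (fromℕ< i<k))
... | no _ = 0

thresholds≤ : ∀ {k} (g : Fin k → Fin (suc k)) i → thresholds g i ≤ k
thresholds≤ {k} g i with i <? k
... | yes i<k = s≤s⁻¹ (Finₚ.toℕ<n (g (fromℕ< i<k)))
... | no _ = z≤n

thresholds-toℕ : ∀ {k} (g : Fin k → Fin (suc k)) x → thresholds g (toℕ x) ≡ toℕ (g x)
thresholds-toℕ {k} g x with toℕ x <? k
... | yes x<k = cong (toℕ ∘ g) (Finₚ.fromℕ<-toℕ x x<k)
... | no x≮k = ⊥-elim (x≮k (Finₚ.toℕ<n x))

≤ᵇ-determined : ∀ {a b k} → a ≤ k → b ≤ k → (∀ {j} → 1 ≤ j → j ≤ k → (j ≤ᵇ a) ≡ (j ≤ᵇ b)) → a ≡ b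
≤ᵇ-determined {a} {b} a≤k b≤k same with <-cmp a b
... | tri≈ _ a≡b _ = a≡b
... | tri< a<b _ _ = ⊥-elim (<⇒≱ a<b (≤ᵇ⇒≤ b a (≡true⇒T (trans (same (≤-trans (s≤s z≤n) a<b) b≤k)
                                                              (T⇒≡true (≤⇒≤ᵇ (≤-refl {b})))))))
... | tri> _ _ b<a = ⊥-elim (<⇒≱ b<a (≤ᵇ⇒≤ a b (≡true⇒T (trans (sym (same (≤-trans (s≤s z≤n) b<a) a≤k))
                                                              (T⇒≡true (≤⇒≤ᵇ (≤-refl {a})))))))

funToFin-cong : ∀ {a b} {f g : Fin a → Fin b} → (∀ i → f i ≡ g i) → funToFin f ≡ funToFin g
funToFin-cong {zero} h = refl
funToFin-cong {suc a} h = cong₂ combine (h Fin.zero) (funToFin-cong (h ∘ Fin.suc))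

module _ (m k : ℕ) (2k≤m : k + k ≤ m) where

  g : Fin (suc k ^ k) → Fin k → Fin (suc k)
  g = finToFun {suc k} {k}

  G : Fin (suc k ^ k) → ℕ → ℕ
  G c = thresholds (g c)

  chainHypergraph : Fin (suc k ^ k) → Hypergraph (suc m)
  chainHypergraph c = evenHypergraph (Chain.chainGraph k (G c))

  private
    bound-A : ∀ {i} → i < k → suc i < suc m
    bound-A i<k = s≤s (≤-trans i<k (≤-trans (m≤m+n k k) 2k≤m))
    bound-B : ∀ {j} → j ≤ k → k + j < suc m
    bound-B j≤k = s≤s (≤-trans (+-monoʳ-≤ k j≤k) 2k≤m)

  chainHypergraph-edge : ∀ c {i j} (i<k : i < k) (1≤j : 1 ≤ j) (j≤k : j ≤ k) →
    isEdge (chainHypergraph c) (Fin.zero , fromℕ< (bound-A i<k) , fromℕ< (bound-B j≤k)) ≡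
    not (j ≤ᵇ G c i)
  chainHypergraph-edge c {i} {j} i<k 1≤j j≤k =
    trans (evenHypergraph-even K (∈-triples⁺ 0<a a<b))
      (trans (cong₂ (λ s t → even₃ s t (K a b)) (chainGraph-zero a) (chainGraph-zero b))
        (cong not (chainGraph-AB (Finₚ.toℕ-fromℕ< (bound-A i<k)) (Finₚ.toℕ-fromℕ< (bound-B j≤k)) i<k 1≤j)))
    where
    open Chain k (G c)
    K = chainGraph {suc m}
    a = fromℕ< (bound-A i<k)
    b = fromℕ< (bound-B j≤k)
    0<a : Fin.zero {m} <ᶠ a
    0<a = subst (0 <_) (sym (Finₚ.toℕ-fromℕ< (bound-A i<k))) z<s
    a<b : a <ᶠ b
    a<b rewrite Finₚ.toℕ-fromℕ< (bound-A i<k) | Finₚ.toℕ-fromℕ< (bound-B j≤k) =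
      subst (_≤ k + j) (+-comm (suc i) 1) (+-mono-≤ i<k 1≤j)

  chainHypergraph-injective : ∀ {c c′} → chainHypergraph c ≡ chainHypergraph c′ → c ≡ c′
  chainHypergraph-injective {c} {c′} e =
    trans (sym (Finₚ.funToFin-finToFin {k} {suc k} c))
      (trans (funToFin-cong same-g) (Finₚ.funToFin-finToFin {k} {suc k} c′))
    where
    same-g : ∀ x → g c x ≡ g c′ x
    same-g x = Finₚ.toℕ-injective (trans (sym (thresholds-toℕ (g c) x))
      (trans (≤ᵇ-determined (thresholds≤ (g c) (toℕ x)) (thresholds≤ (g c′) (toℕ x)) same-edges)
        (thresholds-toℕ (g c′) x)))
      where
      same-edges : ∀ {j} → 1 ≤ j → j ≤ k →
        (j ≤ᵇ G c (toℕ x)) ≡ (j ≤ᵇ G c′ (toℕ x))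
      same-edges 1≤j j≤k = not-injective (trans (sym (chainHypergraph-edge c (Finₚ.toℕ<n x) 1≤j j≤k))
        (trans (cong (λ H → isEdge H (Fin.zero , fromℕ< (bound-A (Finₚ.toℕ<n x)) , fromℕ< (bound-B j≤k))) e)
          (chainHypergraph-edge c′ (Finₚ.toℕ<n x) 1≤j j≤k)))

  chainHypergraph-admissible : ∀ c → chainHypergraph c ∈ filter admissible? (allHypergraphs (suc m))
  chainHypergraph-admissible c = ∈-filter⁺ admissible? (boolFilter∈sublists (evenTriple K) (triples (suc m)))
    (evenHypergraph-admissible K chainGraph-symmetric chainGraph-triangleFree chainGraph-induced2K2Free)
    where
    open Chain k (G c)
    K = chainGraph {suc m}

  [k+1]^k≤f : suc k ^ k ≤ f (suc m) forbidden
  [k+1]^k≤f = ≤-length chainHypergraph chainHypergraph-injective chainHypergraph-admissible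

2+n≤n² : ∀ {n} → 2 ≤ n → 2 + n ≤ n ^ 2
2+n≤n² {n} 2≤n = begin
  2 + n       ≤⟨ +-monoˡ-≤ n 2≤n ⟩
  n + n       ≡⟨ cong (n +_) (sym (+-identityʳ n)) ⟩
  2 * n       ≤⟨ *-monoˡ-≤ n 2≤n ⟩
  n * n       ≡⟨ cong (n *_) (sym (*-identityʳ n)) ⟩
  n ^ 2       ∎
  where open ≤-Reasoning

#Labels≤n¹³ : ∀ {n} → 3 ≤ n → #Labels n ≤ n ^ 13
#Labels≤n¹³ {n} 3≤n = begin
  3 * (suc n ^ 3 * suc (suc n) ^ 3)   ≤⟨ *-mono-≤ 3≤n (*-mono-≤ (^-monoˡ-≤ 3 (≤-trans (n≤1+n _) 2+n≤n²′))
                                                               (^-monoˡ-≤ 3 2+n≤n²′)) ⟩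
  n * ((n ^ 2) ^ 3 * (n ^ 2) ^ 3)     ≡⟨ cong (n *_) (cong₂ _*_ (^-*-assoc n 2 3) (^-*-assoc n 2 3)) ⟩
  n * (n ^ 6 * n ^ 6)                 ≡⟨ cong (n *_) (sym (^-distribˡ-+-* n 6 6)) ⟩
  n ^ 13                              ∎
  where
  open ≤-Reasoning
  2+n≤n²′ = 2+n≤n² (≤-trans (n≤1+n 2) 3≤n)

halve : ∀ m → ∃ λ k → k + k ≤ m × m ≤ suc (k + k)
halve zero = 0 , z≤n , z≤n
halve (suc zero) = 0 , z≤n , s≤s z≤n
halve (suc (suc m)) with halve m
... | k , 2k≤m , m≤2k+1 = suc k ,
  subst (_≤ suc (suc m)) (sym (cong suc (+-suc k k))) (s≤s (s≤s 2k≤m)) ,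
  subst (suc (suc m) ≤_) (sym (cong suc (cong suc (+-suc k k)))) (s≤s (s≤s m≤2k+1))

f≤n^13n : ∀ n → 3 ≤ n → f n forbidden ≤ n ^ (13 * n)
f≤n^13n (suc m) 3≤n = begin
  f (suc m) forbidden       ≤⟨ f≤#Labels^n m ⟩
  #Labels (suc m) ^ suc m   ≤⟨ ^-monoˡ-≤ (suc m) (#Labels≤n¹³ 3≤n) ⟩
  (suc m ^ 13) ^ suc m      ≡⟨ ^-*-assoc (suc m) 13 (suc m) ⟩
  suc m ^ (13 * suc m)      ∎
  where open ≤-Reasoning

n^n≤f^8 : ∀ n → 4 ≤ n → n ^ (1 * n) ≤ f n forbidden ^ 8
n^n≤f^8 (suc m) 4≤n with halve m
... | k , 2k≤m , m≤2k+1 = begin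
  suc m ^ (1 * suc m)       ≡⟨ cong (suc m ^_) (*-identityˡ (suc m)) ⟩
  suc m ^ suc m             ≤⟨ ^-monoˡ-≤ (suc m) n≤[k+1]² ⟩
  (suc k ^ 2) ^ suc m       ≡⟨ ^-*-assoc (suc k) 2 (suc m) ⟩
  suc k ^ (2 * suc m)       ≤⟨ ^-monoʳ-≤ (suc k) 2n≤8k ⟩
  suc k ^ (k * 8)           ≡⟨ sym (^-*-assoc (suc k) k 8) ⟩
  (suc k ^ k) ^ 8           ≤⟨ ^-monoˡ-≤ 8 ([k+1]^k≤f m k 2k≤m) ⟩
  f (suc m) forbidden ^ 8   ∎
  where
  open ≤-Reasoning
  positive : ∀ k → m ≤ suc (k + k) → 1 ≤ k
  positive zero m≤1 = ⊥-elim (<⇒≱ (s≤s⁻¹ 4≤n) (≤-trans m≤1 (s≤s z≤n)))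
  positive (suc _) _ = s≤s z≤n
  1≤k : 1 ≤ k
  1≤k = positive k m≤2k+1
  n≤[k+1]² : suc m ≤ suc k ^ 2
  n≤[k+1]² = begin
    suc m               ≤⟨ s≤s m≤2k+1 ⟩
    suc (suc (k + k))   ≡⟨ solve-∀′ k ⟩
    2 * suc k           ≤⟨ *-monoˡ-≤ (suc k) (s≤s 1≤k) ⟩
    suc k * suc k       ≡⟨ cong (suc k *_) (sym (*-identityʳ (suc k))) ⟩
    suc k ^ 2           ∎
    where
    solve-∀′ : ∀ k → suc (suc (k + k)) ≡ 2 * suc k
    solve-∀′ = solve-∀
  2n≤8k : 2 * suc m ≤ k * 8
  2n≤8k = begin
    2 * suc m                ≤⟨ *-monoʳ-≤ 2 (s≤s m≤2k+1) ⟩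
    2 * suc (suc (k + k))    ≡⟨ expand k ⟩
    4 * 1 + 4 * k            ≤⟨ +-monoˡ-≤ (4 * k) (*-monoʳ-≤ 4 1≤k) ⟩
    4 * k + 4 * k            ≡⟨ collect k ⟩
    k * 8                    ∎
    where
    expand : ∀ k → 2 * suc (suc (k + k)) ≡ 4 * 1 + 4 * k
    expand = solve-∀
    collect : ∀ k → 4 * k + 4 * k ≡ k * 8
    collect = solve-∀

lemma4p3 : ∃[ a ] ∃[ b ] ∃[ C ] ∃[ N ]
    (0 < a × 0 < b ×
      ((n : ℕ) → N ≤ n →
        (n ^ (a * n) ≤ f n (0 ∷ 1 ∷ 3 ∷ []) ^ b)
        × (f n (0 ∷ 1 ∷ 3 ∷ []) ≤ n ^ (C * n))))
lemma4p3 = 1 , 8 , 13 , 4 , s≤s z≤n , s≤s z≤n ,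
  λ n 4≤n → n^n≤f^8 n 4≤n , f≤n^13n n (≤-trans (n≤1+n 3) 4≤n)
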